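{- Let $\kappa\in\{2,3,4\}$ and let $G$ be a $\kappa$-regular graph on $\kappa^2+1$ vertices admitting an adjacency matrix $A$ with $\Theta^m(A)=A$ for some integer $m\ge1$. Let $v_0$ be a centre of $G$ with radius $2$ (a vertex with $d_G(v_0,w)\le2$ for all $w\in V(G)$), let $v_1,\dots,v_\kappa$ be the $\kappa$ neighbours of $v_0$, and for each $i=1,\dots,\kappa$ let $v_{i,1},\dots,v_{i,\kappa-1}$ be the $\kappa-1$ neighbours of $v_i$ other than $v_0$. Then $$V(G)=\{v_0,v_1,\dots,v_\kappa,v_{1,1},\dots,v_{1,\kappa-1},v_{2,1},\dots,v_{2,\kappa-1},\dots,v_{\kappa,1},\dots,v_{\kappa,\kappa-1}\},$$ these $\kappa^2+1$ listed vertices being pairwise distinct.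
   Context: For an $n\times n$ integer matrix $X$ whose row and column sums all equal an integer $\lambda$, define $\Theta(X):=(\lambda-1)I_n+J_n-XX^{\mathrm T}$, where $I_n$ is the identity and $J_n$ the all-one matrix of order $n$; $\Theta(X)$ again has constant row and column sums, and $\Theta^m$ denotes the $m$-fold iterate, each application using the common row/column sum of its argument. Graphs are simple and undirected. -}

module Defs where

open import Data.Nat using (ℕ; zero; suc; _≤_)
open import Data.Integer using (ℤ; +_; _+_; _-_; _*_)
open import Data.Fin using (Fin; zero; suc)
open import Data.Product using (Σ; _×_; ∃-syntax)
open import Data.Sum using (_⊎_)
open import Relation.Binary.PropositionalEquality using (_≡_)
open import Relation.Nullary using (¬_)
open import Data.Fin using (_≟_)
open import Relation.Nullary.Decidable using (does)
open import Data.Bool using (if_then_else_)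

Mat : ℕ → Set
Mat n = Fin n → Fin n → ℤ

sumℤ : ∀ {n} → (Fin n → ℤ) → ℤ
sumℤ {zero}  f = + 0
sumℤ {suc n} f = f zero + sumℤ (λ k → f (suc k))

-- common row sum of a matrix (read off the first row; the matrices
-- considered have constant row and column sums)
rowSum : ∀ {n} → Mat (suc n) → ℤ
rowSum X = sumℤ (X zero)

δ : ∀ {n} → Fin n → Fin n → ℤ
δ i j = if does (i ≟ j) then + 1 else + 0

Θ : ∀ {n} → Mat (suc n) → Mat (suc n)
Θ X i j = (rowSum X - + 1) * δ i j + + 1 - sumℤ (λ k → X i k * X j k)

Θ^ : ∀ {n} → ℕ → Mat (suc n) → Mat (suc n)
Θ^ zero    X = X
Θ^ (suc m) X = Θ (Θ^ m X)

record IsAdjMatrix {n : ℕ} (A : Mat n) : Set where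
  field
    zero-one  : ∀ i j → A i j ≡ + 0 ⊎ A i j ≡ + 1
    symmetric : ∀ i j → A i j ≡ A j i
    loopless  : ∀ i → A i i ≡ + 0

Adj : ∀ {n} → Mat n → Fin n → Fin n → Set
Adj A u v = A u v ≡ + 1

Regular : ∀ {n} → ℕ → Mat n → Set
Regular κ A = ∀ i → sumℤ (A i) ≡ + κ

data Walk {n : ℕ} (A : Mat n) : ℕ → Fin n → Fin n → Set where
  here : ∀ {u} → Walk A 0 u u
  step : ∀ {k u v w} → Adj A u v → Walk A k v w → Walk A (suc k) u w

DistLe : ∀ {n} → Mat n → Fin n → Fin n → ℕ → Set
DistLe A u w k = ∃[ l ] (l ≤ k × Walk A l u w)

module Submission where

open import Defs
open import Data.Nat using (ℕ; zero; suc; _*_; _∸_; _≤_; _+_; s≤s)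
open import Data.Nat.Properties using (*-suc; 1+n≰n)
open import Data.Fin using (Fin; punchOut; _≟_)
open import Data.Fin.Properties using (1↔⊤; +↔⊎; *↔×; any?; punchOut-injective; injective⇒≤)
open import Data.Product using (_×_; ∃-syntax; _,_; proj₁; proj₂)
open import Data.Product.Function.NonDependent.Propositional using (_×-↔_)
open import Data.Sum using (_⊎_; [_,_]; inj₁; inj₂)
open import Data.Sum.Function.Propositional using (_⊎-↔_)
open import Data.Unit using (⊤; tt)
open import Data.Empty using (⊥-elim)
open import Function.Bundles using (_↔_; Inverse)
open import Function.Definitions using (Injective; Surjective; StrictlySurjective)
open import Function.Consequences.Propositional using (strictlySurjective⇒surjective)
open import Function.Properties.Inverse using (↔-refl; ↔-trans)
open import Relation.Binary.PropositionalEquality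
  using (_≡_; _≢_; refl; sym; trans; cong; subst; module ≡-Reasoning)
open import Relation.Nullary using (yes; no)

-- Every vertex lies within distance 2 of v₀, so it is v₀, some vᵢ or some vᵢⱼ:
-- the listing is onto. It is indexed by a set of 1 + κ + κ(κ − 1) = κ² + 1
-- elements, the number of vertices, and a surjection between finite sets of the
-- same size is injective.

Fin-injective⇒strictlySurjective : ∀ {n} {f : Fin n → Fin n} →
  Injective _≡_ _≡_ f → StrictlySurjective _≡_ f
Fin-injective⇒strictlySurjective {suc n} {f} f-inj y with any? (λ x → f x ≟ y)
... | yes hit = hit
... | no miss = ⊥-elim (1+n≰n (injective⇒≤ g-inj))
  where
  f≢y : ∀ x → y ≢ f x
  f≢y x y≡fx = miss (x , sym y≡fx)

  -- f misses y, so it factors through Fin n by deleting y.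
  g : Fin (suc n) → Fin n
  g x = punchOut (f≢y x)

  g-inj : Injective _≡_ _≡_ g
  g-inj gx≡gx′ = f-inj (punchOut-injective (f≢y _) (f≢y _) gx≡gx′)

Fin-strictlySurjective⇒injective : ∀ {n} {f : Fin n → Fin n} →
  StrictlySurjective _≡_ f → Injective _≡_ _≡_ f
Fin-strictlySurjective⇒injective {f = f} f-surj {x} {x′} fx≡fx′ = begin
  x       ≡⟨ sym (proj₂ (s-surj x)) ⟩
  s a     ≡⟨ cong s a≡a′ ⟩
  s a′    ≡⟨ proj₂ (s-surj x′) ⟩
  x′      ∎
  where
  open ≡-Reasoning
  -- a section s of f is injective, hence onto, so x and x′ are of the form s a.
  s : Fin _ → Fin _
  s y = proj₁ (f-surj y)
  f∘s≡id : ∀ y → f (s y) ≡ y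
  f∘s≡id y = proj₂ (f-surj y)
  s-surj : StrictlySurjective _≡_ s
  s-surj = Fin-injective⇒strictlySurjective λ {y} {y′} sy≡sy′ → begin
    y         ≡⟨ sym (f∘s≡id y) ⟩
    f (s y)   ≡⟨ cong f sy≡sy′ ⟩
    f (s y′)  ≡⟨ f∘s≡id y′ ⟩
    y′        ∎
  a a′ : Fin _
  a  = proj₁ (s-surj x)
  a′ = proj₁ (s-surj x′)
  a≡a′ : a ≡ a′
  a≡a′ = begin
    a         ≡⟨ sym (f∘s≡id a) ⟩
    f (s a)   ≡⟨ cong f (proj₂ (s-surj x)) ⟩
    f x       ≡⟨ fx≡fx′ ⟩
    f x′      ≡⟨ cong f (sym (proj₂ (s-surj x′))) ⟩
    f (s a′)  ≡⟨ f∘s≡id a′ ⟩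
    a′        ∎

strictlySurjective⇒injective : ∀ {a} {n} {D : Set a} → Fin n ↔ D →
  (L : D → Fin n) → StrictlySurjective _≡_ L → Injective _≡_ _≡_ L
strictlySurjective⇒injective e L L-surj {x} {x′} Lx≡Lx′ = begin
  x               ≡⟨ sym (strictlyInverseˡ x) ⟩
  to (from x)     ≡⟨ cong to (L-equal⇒from-equal Lx≡Lx′) ⟩
  to (from x′)    ≡⟨ strictlyInverseˡ x′ ⟩
  x′              ∎
  where
  open ≡-Reasoning
  open Inverse e using (to; from; strictlyInverseˡ)

  L∘to-surj : StrictlySurjective _≡_ (λ i → L (to i))
  L∘to-surj y with d , Ld≡y ← L-surj y =
    from d , trans (cong L (strictlyInverseˡ d)) Ld≡y

  L-equal⇒from-equal : ∀ {d d′} → L d ≡ L d′ → from d ≡ from d′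
  L-equal⇒from-equal {d} {d′} Ld≡Ld′ = Fin-strictlySurjective⇒injective L∘to-surj (begin
    L (to (from d))   ≡⟨ cong L (strictlyInverseˡ d) ⟩
    L d               ≡⟨ Ld≡Ld′ ⟩
    L d′              ≡⟨ cong L (sym (strictlyInverseˡ d′)) ⟩
    L (to (from d′))  ∎)

Ball₂ : ℕ → Set
Ball₂ κ = ⊤ ⊎ Fin κ ⊎ (Fin κ × Fin (κ ∸ 1))

suc[κ*κ]≡1+κ+κ*[κ∸1] : ∀ κ → suc (κ * κ) ≡ 1 + (κ + κ * (κ ∸ 1))
suc[κ*κ]≡1+κ+κ*[κ∸1] zero    = refl
suc[κ*κ]≡1+κ+κ*[κ∸1] (suc κ) = cong suc (*-suc (suc κ) κ)

Fin[1+κ*κ]↔Ball₂ : ∀ κ → Fin (suc (κ * κ)) ↔ Ball₂ κ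
Fin[1+κ*κ]↔Ball₂ κ = subst (λ n → Fin n ↔ Ball₂ κ) (sym (suc[κ*κ]≡1+κ+κ*[κ∸1] κ))
  (↔-trans +↔⊎ (1↔⊤ ⊎-↔ ↔-trans +↔⊎ (↔-refl ⊎-↔ *↔×)))

ball₂-listing : ∀ {n κ} → Fin n → (Fin κ → Fin n) → (Fin κ → Fin (κ ∸ 1) → Fin n) →
  Ball₂ κ → Fin n
ball₂-listing v₀ v vv = [ (λ _ → v₀) , [ v , (λ p → vv (proj₁ p) (proj₂ p)) ] ]

ball₂-listing-strictlySurjective : ∀ {n κ} (A : Mat n) (v₀ : Fin n) →
  (∀ w → DistLe A v₀ w 2) →
  (v : Fin κ → Fin n) → (∀ u → Adj A v₀ u → ∃[ i ] (v i ≡ u)) →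
  (vv : Fin κ → Fin (κ ∸ 1) → Fin n) →
  (∀ i u → Adj A (v i) u → u ≢ v₀ → ∃[ j ] (vv i j ≡ u)) →
  StrictlySurjective _≡_ (ball₂-listing v₀ v vv)
ball₂-listing-strictlySurjective A v₀ radius v v-all vv vv-all w with radius w
... | 0 , _ , here = inj₁ tt , refl
... | 1 , _ , step v₀∼w here = inj₂ (inj₁ (proj₁ (v-all w v₀∼w))) , proj₂ (v-all w v₀∼w)
... | 2 , _ , step {v = u} v₀∼u (step u∼w here) with v-all u v₀∼u | w ≟ v₀
...   | _ , _    | yes w≡v₀ = inj₁ tt , sym w≡v₀
...   | i , vi≡u | no w≢v₀
  with j , vvij≡w ← vv-all i w (subst (λ t → Adj A t w) (sym vi≡u) u∼w) w≢v₀ =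
  inj₂ (inj₂ (i , j)) , vvij≡w
ball₂-listing-strictlySurjective A v₀ radius v v-all vv vv-all w
  | suc (suc (suc _)) , s≤s (s≤s ()) , _

corollary3p4 :
    (κ : ℕ) → κ ≡ 2 ⊎ κ ≡ 3 ⊎ κ ≡ 4 →
    (A : Mat (suc (κ * κ))) → IsAdjMatrix A → Regular κ A →
    (∃[ m ] (1 ≤ m × (∀ i j → Θ^ m A i j ≡ A i j))) →
    (v₀ : Fin (suc (κ * κ))) → (∀ w → DistLe A v₀ w 2) →
    (v : Fin κ → Fin (suc (κ * κ))) →
    Injective _≡_ _≡_ v → (∀ i → Adj A v₀ (v i)) →
    (∀ u → Adj A v₀ u → ∃[ i ] (v i ≡ u)) →
    (vv : Fin κ → Fin (κ ∸ 1) → Fin (suc (κ * κ))) →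
    (∀ i → Injective _≡_ _≡_ (vv i)) →
    (∀ i j → Adj A (v i) (vv i j)) →
    (∀ i j → vv i j ≢ v₀) →
    (∀ i u → Adj A (v i) u → u ≢ v₀ → ∃[ j ] (vv i j ≡ u)) →
    let L : ⊤ ⊎ Fin κ ⊎ (Fin κ × Fin (κ ∸ 1)) → Fin (suc (κ * κ))
        L = [ (λ _ → v₀) , [ v , (λ p → vv (proj₁ p) (proj₂ p)) ] ]
    in Injective _≡_ _≡_ L × Surjective _≡_ _≡_ L
corollary3p4 κ _ A _ _ _ v₀ radius v _ _ v-all vv _ _ _ vv-all =
  strictlySurjective⇒injective (Fin[1+κ*κ]↔Ball₂ κ) L L-surj ,
  strictlySurjective⇒surjective L-surj
  where
  L : Ball₂ κ → Fin (suc (κ * κ))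
  L = ball₂-listing v₀ v vv
  L-surj : StrictlySurjective _≡_ L
  L-surj = ball₂-listing-strictlySurjective A v₀ radius v v-all vv vv-all
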